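{- For every integer $n\ge 2$, the ladder $P_n\,\square\,P_2$ satisfies $\Theta(P_n\,\square\,P_2)=2$.
   Context: $P_n$ denotes the path on $n$ vertices and $\square$ the Cartesian product of graphs, so $P_n\square P_2$ is obtained from two copies of $P_n$ by joining each pair of corresponding vertices. For an integer $k\ge 0$, a graph $G=(V,E)$ is a $k$-threshold graph with thresholds $\theta_1<\dots<\theta_k$ if there is $r:V\to\mathbb{R}$ such that for any two distinct $u,v\in V$, $uv\in E$ if and only if $r(u)+r(v)\ge\theta_i$ for an odd number of indices $i\in\{1,\dots,k\}$. The threshold number $\Theta(G)$ is the smallest $k\ge 0$ such that $G$ is a $k$-threshold graph.
   Formalization: The rank function $r$ and the thresholds $\theta_i$ take values in ℚ rather than in ℝ. -}

module Defs where

open import Data.Nat as ℕ using (ℕ; zero; suc; _%_)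
open import Data.Fin as Fin using (Fin; toℕ)
open import Data.Product using (Σ; _×_; _,_)
open import Data.Sum using (_⊎_)
open import Data.Rational as ℚ using (ℚ; _+_)
open import Data.Rational.Properties using (_≤?_)
open import Relation.Nullary using (¬_; yes; no)
open import Relation.Binary.PropositionalEquality using (_≡_; _≢_)
open import Function.Bundles using (_⇔_)

record Graph : Set₁ where
  field
    V   : Set
    Adj : V → V → Set

countLe : (k : ℕ) → (Fin k → ℚ) → ℚ → ℕ
countLe zero    θ s = 0
countLe (suc k) θ s with θ Fin.zero ≤? s
... | yes _ = suc (countLe k (λ i → θ (Fin.suc i)) s)
... | no  _ = countLe k (λ i → θ (Fin.suc i)) s

Odd : ℕ → Set
Odd n = n % 2 ≡ 1

-- G is a k-threshold graph: there are thresholds θ₁ < … < θ_k and a rank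
-- function r such that for distinct u v, uv ∈ E iff r u + r v ≥ θ_i for an
-- odd number of indices i.  (Rationals are used in place of reals.)
IsKThreshold : ℕ → Graph → Set
IsKThreshold k G =
  Σ (Fin k → ℚ) λ θ →
  Σ (V → ℚ) λ r →
    (∀ (i j : Fin k) → i Fin.< j → θ i ℚ.< θ j) ×
    (∀ (u v : V) → u ≢ v → (Adj u v ⇔ Odd (countLe k θ (r u + r v))))
  where open Graph G

ThresholdNumberIs : Graph → ℕ → Set
ThresholdNumberIs G m = IsKThreshold m G × (∀ k → k ℕ.< m → ¬ IsKThreshold k G)

LadderAdj : (n : ℕ) → (Fin n × Fin 2) → (Fin n × Fin 2) → Set
LadderAdj n (i , a) (j , b) =
  (a ≡ b × (suc (toℕ i) ≡ toℕ j ⊎ suc (toℕ j) ≡ toℕ i)) ⊎ (i ≡ j × a ≢ b)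

Ladder : ℕ → Graph
Ladder n = record { V = Fin n × Fin 2 ; Adj = LadderAdj n }

{-# OPTIONS --safe #-}

-- Give the vertex (i , a) the rank (−1)^(i+a)·(i+1) and take the thresholds −1 < 2, so that
-- u v is an edge iff −1 ≤ r u + r v < 2. Ranks of equal sign sum to at least 2 or at most −2;
-- ranks of opposite sign sum to ± the difference of the rows, which lies in [−1, 2) iff the rows
-- differ by at most one. In the chessboard colouring (−1)^(i+a) two vertices of the ladder are
-- adjacent exactly when their colours differ and their rows differ by at most one.
-- Conversely the ladder has an edge, so Θ ≠ 0; and for a = (0,0), b = (1,0), c = (1,1),
-- d = (0,1) the pairs ab, cd are edges while ac, bd are not, so a single threshold θ would give
-- 2θ ≤ (r a + r b) + (r c + r d) = (r a + r c) + (r b + r d) < 2θ.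

module Submission where

open import Defs
open import Data.Nat using (ℕ; _≥_)

open import Level using (0ℓ)
open import Function using (_∘_)
open import Function.Bundles using (_⇔_; mk⇔; Equivalence)
open import Function.Properties.Equivalence as ⇔ using (⇔-setoid)
open import Data.Product using (_×_; _,_; proj₂)
open import Data.Product.Function.NonDependent.Propositional using (_×-⇔_)
open import Data.Sum using (_⊎_; inj₁; inj₂)
import Data.Sum as Sum
open import Relation.Nullary using (¬_; yes; no; contradiction)
open import Relation.Binary.PropositionalEquality
open import Data.Nat as ℕ using (zero; suc; s≤s; z≤n)
import Data.Nat.Properties as ℕ
open import Data.Fin as Fin using (Fin; toℕ)
open import Data.Fin.Patterns using (0F; 1F)
import Data.Fin.Properties as Fin
open import Data.Parity as ℙ using (Parity; 0ℙ; 1ℙ; _⁻¹; toSign)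
import Data.Parity.Properties as ℙ
open import Data.Integer as ℤ using (ℤ; +_; -1ℤ; _⊖_; _◃_)
import Data.Integer.Properties as ℤ
open import Data.Rational as ℚ using (ℚ)
open import Data.Rational.Literals using (fromℤ)
import Data.Rational.Properties as ℚ
open import Data.Rational.Unnormalised using (mkℚᵘ)
import Data.Rational.Unnormalised.Properties as ℚᵘ
open import Algebra.Bundles using (CommutativeMonoid)
open import Algebra.Properties.CommutativeSemigroup
  (CommutativeMonoid.commutativeSemigroup ℚ.+-0-commutativeMonoid) using (interchange)

open Equivalence

Odd-suc : ∀ n → Odd (suc n) ⇔ (¬ Odd n)
Odd-suc 0             = mk⇔ (λ _ ()) (λ _ → refl)
Odd-suc 1             = mk⇔ (λ ()) (λ ¬odd → contradiction refl ¬odd)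
Odd-suc (suc (suc n)) = Odd-suc n

Odd-countLe-1 : (θ : Fin 1 → ℚ) (s : ℚ) → Odd (countLe 1 θ s) ⇔ θ 0F ℚ.≤ s
Odd-countLe-1 θ s with θ 0F ℚ.≤? s
... | yes θ≤s = mk⇔ (λ _ → θ≤s) (λ _ → refl)
... | no  θ≰s = mk⇔ (λ ()) (λ θ≤s → contradiction θ≤s θ≰s)

Odd-countLe-2 : (θ : Fin 2 → ℚ) → θ 0F ℚ.< θ 1F → (s : ℚ) →
                Odd (countLe 2 θ s) ⇔ (θ 0F ℚ.≤ s × s ℚ.< θ 1F)
Odd-countLe-2 θ θ₀<θ₁ s
  with θ 0F ℚ.≤? s | Odd-countLe-1 (θ ∘ Fin.suc) s | Odd-suc (countLe 1 (θ ∘ Fin.suc) s)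
... | yes θ₀≤s | above | flips = mk⇔
  (λ odd → θ₀≤s , ℚ.≰⇒> (to flips odd ∘ from above))
  (λ (_ , s<θ₁) → from flips (ℚ.<-irrefl refl ∘ ℚ.<-≤-trans s<θ₁ ∘ to above))
... | no θ₀≰s  | above | _ = mk⇔
  (λ odd → contradiction (ℚ.<⇒≤ (ℚ.<-≤-trans θ₀<θ₁ (to above odd))) θ₀≰s)
  (λ (θ₀≤s , _) → contradiction θ₀≤s θ₀≰s)

fromℤ-homo-+ : ∀ a b → fromℤ (a ℤ.+ b) ≡ fromℤ a ℚ.+ fromℤ b
fromℤ-homo-+ a b = ℚ.toℚᵘ-injective (ℚᵘ.≃-sym (ℚᵘ.≃-trans
  (ℚ.toℚᵘ-homo-+ (fromℤ a) (fromℤ b))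
  (ℚᵘ.≃-reflexive (cong (λ n → mkℚᵘ n 0)
                        (cong₂ ℤ._+_ (ℤ.*-identityʳ a) (ℤ.*-identityʳ b))))))

fromℤ-≤⇔ : ∀ {a b} → fromℤ a ℚ.≤ fromℤ b ⇔ a ℤ.≤ b
fromℤ-≤⇔ {a} {b} = mk⇔
  (λ { (ℚ.*≤* a≤b) → subst₂ ℤ._≤_ (ℤ.*-identityʳ a) (ℤ.*-identityʳ b) a≤b })
  (ℚ.*≤* ∘ subst₂ ℤ._≤_ (sym (ℤ.*-identityʳ a)) (sym (ℤ.*-identityʳ b)))

fromℤ-<⇔ : ∀ {a b} → fromℤ a ℚ.< fromℤ b ⇔ a ℤ.< b
fromℤ-<⇔ {a} {b} = mk⇔
  (λ { (ℚ.*<* a<b) → subst₂ ℤ._<_ (ℤ.*-identityʳ a) (ℤ.*-identityʳ b) a<b })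
  (ℚ.*<* ∘ subst₂ ℤ._<_ (sym (ℤ.*-identityʳ a)) (sym (ℤ.*-identityʳ b)))

record TwoSwitch (G : Graph) : Set where
  open Graph G
  field
    a b c d : V
    a≢b : a ≢ b
    c≢d : c ≢ d
    a≢c : a ≢ c
    b≢d : b ≢ d
    ab  : Adj a b
    cd  : Adj c d
    ¬ac : ¬ Adj a c
    ¬bd : ¬ Adj b d

module _ {G : Graph} where
  open Graph G

  0-threshold⇒edgeless : IsKThreshold 0 G → ∀ u v → u ≢ v → ¬ Adj u v
  0-threshold⇒edgeless (_ , _ , _ , adj⇔) u v u≢v uv with to (adj⇔ u v u≢v) uv
  ... | ()

  twoSwitch⇒¬1-threshold : TwoSwitch G → ¬ IsKThreshold 1 G
  twoSwitch⇒¬1-threshold sw (θ , r , _ , adj⇔) = ℚ.<-irrefl refl (begin-strict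
    θ₀ ℚ.+ θ₀                              ≤⟨ ℚ.+-mono-≤ (above a≢b ab) (above c≢d cd) ⟩
    (r a ℚ.+ r b) ℚ.+ (r c ℚ.+ r d)        ≡⟨ interchange (r a) (r b) (r c) (r d) ⟩
    (r a ℚ.+ r c) ℚ.+ (r b ℚ.+ r d)        <⟨ ℚ.+-mono-< (below a≢c ¬ac) (below b≢d ¬bd) ⟩
    θ₀ ℚ.+ θ₀                              ∎)
    where
    open TwoSwitch sw
    open ℚ.≤-Reasoning
    θ₀ : ℚ
    θ₀ = θ 0F
    above : ∀ {u v} → u ≢ v → Adj u v → θ₀ ℚ.≤ r u ℚ.+ r v
    above u≢v = to (Odd-countLe-1 θ _) ∘ to (adj⇔ _ _ u≢v)
    below : ∀ {u v} → u ≢ v → ¬ Adj u v → r u ℚ.+ r v ℚ.< θ₀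
    below u≢v ¬uv = ℚ.≰⇒> (¬uv ∘ from (adj⇔ _ _ u≢v) ∘ from (Odd-countLe-1 θ _))

  integerWindow⇒2-threshold : (r : V → ℤ) {lo hi : ℤ} → lo ℤ.< hi →
    (∀ u v → u ≢ v → Adj u v ⇔ (lo ℤ.≤ r u ℤ.+ r v × r u ℤ.+ r v ℤ.< hi)) →
    IsKThreshold 2 G
  integerWindow⇒2-threshold r {lo} {hi} lo<hi adj⇔ =
    θ , fromℤ ∘ r , increasing , λ u v u≢v → begin
      Adj u v                                                    ≈⟨ adj⇔ u v u≢v ⟩
      (lo ℤ.≤ r u ℤ.+ r v × r u ℤ.+ r v ℤ.< hi)                  ≈⟨ ⇔.sym (fromℤ-≤⇔ ×-⇔ fromℤ-<⇔) ⟩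
      (θ 0F ℚ.≤ fromℤ (r u ℤ.+ r v) × fromℤ (r u ℤ.+ r v) ℚ.< θ 1F)
        ≡⟨ cong (λ s → θ 0F ℚ.≤ s × s ℚ.< θ 1F) (fromℤ-homo-+ (r u) (r v)) ⟩
      (θ 0F ℚ.≤ fromℤ (r u) ℚ.+ fromℤ (r v) × fromℤ (r u) ℚ.+ fromℤ (r v) ℚ.< θ 1F)
        ≈⟨ ⇔.sym (Odd-countLe-2 θ θ₀<θ₁ _) ⟩
      Odd (countLe 2 θ (fromℤ (r u) ℚ.+ fromℤ (r v)))           ∎
    where
    open import Relation.Binary.Reasoning.Setoid (⇔-setoid 0ℓ)
    θ : Fin 2 → ℚ
    θ 0F = fromℤ lo
    θ 1F = fromℤ hi
    θ₀<θ₁ : θ 0F ℚ.< θ 1F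
    θ₀<θ₁ = from fromℤ-<⇔ lo<hi
    increasing : ∀ i j → i Fin.< j → θ i ℚ.< θ j
    increasing 0F 1F _ = θ₀<θ₁
    increasing 0F 0F ()
    increasing 1F 0F ()
    increasing 1F 1F (s≤s ())

WithinOne : ℕ → ℕ → Set
WithinOne m k = m ≡ k ⊎ suc m ≡ k ⊎ suc k ≡ m

WithinOne-sym : ∀ {m k} → WithinOne m k → WithinOne k m
WithinOne-sym (inj₁ m≡k)         = inj₁ (sym m≡k)
WithinOne-sym (inj₂ (inj₁ up))   = inj₂ (inj₂ up)
WithinOne-sym (inj₂ (inj₂ down)) = inj₂ (inj₁ down)

WithinOne-suc : ∀ {m k} → WithinOne (suc m) (suc k) ⇔ WithinOne m k
WithinOne-suc = mk⇔ (Sum.map ℕ.suc-injective (Sum.map ℕ.suc-injective ℕ.suc-injective))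
                    (Sum.map (cong suc) (Sum.map (cong suc) (cong suc)))

-1≤_<2 : ℤ → Set
-1≤ s <2 = -1ℤ ℤ.≤ s × s ℤ.< + 2

-1≤⊖<2⇔WithinOne : ∀ m k → -1≤ m ⊖ k <2 ⇔ WithinOne m k
-1≤⊖<2⇔WithinOne zero          zero          = mk⇔ (λ _ → inj₁ refl)
                                                    (λ _ → ℤ.-≤+ , ℤ.+<+ (s≤s z≤n))
-1≤⊖<2⇔WithinOne zero          (suc zero)    = mk⇔ (λ _ → inj₂ (inj₁ refl))
                                                    (λ _ → ℤ.≤-refl , ℤ.-<+)
-1≤⊖<2⇔WithinOne (suc zero)    zero          = mk⇔ (λ _ → inj₂ (inj₂ refl))
                                                    (λ _ → ℤ.-≤+ , ℤ.+<+ (s≤s (s≤s z≤n)))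
-1≤⊖<2⇔WithinOne zero          (suc (suc k)) = mk⇔ (λ { (ℤ.-≤- () , _) })
                                                    λ { (inj₁ ()) ; (inj₂ (inj₁ ())) ; (inj₂ (inj₂ ())) }
-1≤⊖<2⇔WithinOne (suc (suc m)) zero          = mk⇔ (λ { (_ , ℤ.+<+ (s≤s (s≤s ()))) })
                                                    λ { (inj₁ ()) ; (inj₂ (inj₁ ())) ; (inj₂ (inj₂ ())) }
-1≤⊖<2⇔WithinOne (suc m)       (suc k)       rewrite ℤ.[1+m]⊖[1+n]≡m⊖n m k =
  ⇔.trans (-1≤⊖<2⇔WithinOne m k) (⇔.sym WithinOne-suc)

signedSum-window : ∀ p q m k →
  -1≤ (toSign p ◃ suc m) ℤ.+ (toSign q ◃ suc k) <2 ⇔ (p ≢ q × WithinOne m k)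
signedSum-window 0ℙ 0ℙ m k = mk⇔
  (λ { (_ , ℤ.+<+ (s≤s (s≤s m+1+k≤0))) → contradiction (ℕ.n≤0⇒n≡0 m+1+k≤0) (ℕ.m+1+n≢0 m) })
  (λ (p≢q , _) → contradiction refl p≢q)
signedSum-window 1ℙ 1ℙ m k = mk⇔ (λ { (ℤ.-≤- () , _) }) (λ (p≢q , _) → contradiction refl p≢q)
signedSum-window 0ℙ 1ℙ m k rewrite ℤ.[1+m]⊖[1+n]≡m⊖n m k =
  ⇔.trans (-1≤⊖<2⇔WithinOne m k) (mk⇔ ((λ ()) ,_) proj₂)
signedSum-window 1ℙ 0ℙ m k rewrite ℤ.[1+m]⊖[1+n]≡m⊖n k m =
  ⇔.trans (-1≤⊖<2⇔WithinOne k m) (mk⇔ (λ w → (λ ()) , WithinOne-sym w) (WithinOne-sym ∘ proj₂))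

≢⁻¹⇒≡ : ∀ {p q : Parity} → p ≢ q ⁻¹ → p ≡ q
≢⁻¹⇒≡ {0ℙ} {0ℙ} _ = refl
≢⁻¹⇒≡ {1ℙ} {1ℙ} _ = refl
≢⁻¹⇒≡ {0ℙ} {1ℙ} p≢q⁻¹ = contradiction refl p≢q⁻¹
≢⁻¹⇒≡ {1ℙ} {0ℙ} p≢q⁻¹ = contradiction refl p≢q⁻¹

parity∘toℕ-injective : ∀ {a b : Fin 2} → ℕ.parity (toℕ a) ≡ ℕ.parity (toℕ b) → a ≡ b
parity∘toℕ-injective {0F} {0F} _ = refl
parity∘toℕ-injective {1F} {1F} _ = refl
parity∘toℕ-injective {0F} {1F} ()
parity∘toℕ-injective {1F} {0F} ()

module _ {n : ℕ} where

  row : Fin n × Fin 2 → ℕ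
  row (i , _) = toℕ i

  colour : Fin n × Fin 2 → Parity
  colour (i , a) = ℕ.parity (toℕ i ℕ.+ toℕ a)

  rank : Fin n × Fin 2 → ℤ
  rank u = toSign (colour u) ◃ suc (row u)

  colour-injectiveʳ : ∀ i {a b} → colour (i , a) ≡ colour (i , b) → a ≡ b
  colour-injectiveʳ i {a} {b} same =
    parity∘toℕ-injective (ℙ.+-cancelˡ-≡ (ℕ.parity (toℕ i)) _ _ (begin
      ℕ.parity (toℕ i) ℙ.+ ℕ.parity (toℕ a) ≡⟨ ℙ.+-homo-+ (toℕ i) (toℕ a) ⟨
      colour (i , a)                        ≡⟨ same ⟩
      colour (i , b)                        ≡⟨ ℙ.+-homo-+ (toℕ i) (toℕ b) ⟩
      ℕ.parity (toℕ i) ℙ.+ ℕ.parity (toℕ b) ∎))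
    where open ≡-Reasoning

  colour-nextRow : ∀ {i j} a → suc (toℕ i) ≡ toℕ j → colour (j , a) ≡ colour (i , a) ⁻¹
  colour-nextRow {i} {j} a i+1≡j = begin
    ℕ.parity (toℕ j ℕ.+ toℕ a)        ≡⟨ cong (λ x → ℕ.parity (x ℕ.+ toℕ a)) i+1≡j ⟨
    ℕ.parity (suc (toℕ i ℕ.+ toℕ a))  ≡⟨ ℙ.⁻¹-selfInverse (ℙ.suc-homo-⁻¹ (toℕ i ℕ.+ toℕ a)) ⟨
    colour (i , a) ⁻¹                 ∎
    where open ≡-Reasoning

  nextRow-colour≢⇒sameColumn : ∀ {i j a b} → suc (toℕ i) ≡ toℕ j →
                               colour (i , a) ≢ colour (j , b) → a ≡ b
  nextRow-colour≢⇒sameColumn {i} {a = a} {b} i+1≡j differ =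
    colour-injectiveʳ i (≢⁻¹⇒≡ (subst (colour (i , a) ≢_) (colour-nextRow b i+1≡j) differ))

  ladderAdj⇔ : ∀ u v → LadderAdj n u v ⇔ (colour u ≢ colour v × WithinOne (row u) (row v))
  ladderAdj⇔ u v = mk⇔ (adjacent⇒ u v) (⇒adjacent u v)
    where
    adjacent⇒ : ∀ u v → LadderAdj n u v → colour u ≢ colour v × WithinOne (row u) (row v)
    adjacent⇒ (i , a) (j , a) (inj₁ (refl , inj₁ i+1≡j)) =
      (λ same → ℙ.p≢p⁻¹ _ (trans same (colour-nextRow a i+1≡j))) , inj₂ (inj₁ i+1≡j)
    adjacent⇒ (i , a) (j , a) (inj₁ (refl , inj₂ j+1≡i)) =
      (λ same → ℙ.p≢p⁻¹ _ (trans (sym same) (colour-nextRow a j+1≡i))) , inj₂ (inj₂ j+1≡i)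
    adjacent⇒ (i , a) (i , b) (inj₂ (refl , a≢b)) = a≢b ∘ colour-injectiveʳ i , inj₁ refl
    ⇒adjacent : ∀ u v → colour u ≢ colour v × WithinOne (row u) (row v) → LadderAdj n u v
    ⇒adjacent (i , a) (j , b) (differ , inj₁ i≡j) with Fin.toℕ-injective i≡j
    ... | refl = inj₂ (refl , λ { refl → differ refl })
    ⇒adjacent (i , a) (j , b) (differ , inj₂ (inj₁ i+1≡j)) =
      inj₁ (nextRow-colour≢⇒sameColumn i+1≡j differ , inj₁ i+1≡j)
    ⇒adjacent (i , a) (j , b) (differ , inj₂ (inj₂ j+1≡i)) =
      inj₁ (sym (nextRow-colour≢⇒sameColumn j+1≡i (differ ∘ sym)) , inj₂ j+1≡i)

  ladderAdj⇔rankWindow : ∀ u v → LadderAdj n u v ⇔ -1≤ rank u ℤ.+ rank v <2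
  ladderAdj⇔rankWindow u v =
    ⇔.trans (ladderAdj⇔ u v) (⇔.sym (signedSum-window (colour u) (colour v) (row u) (row v)))

ladder-2-threshold : ∀ n → IsKThreshold 2 (Ladder n)
ladder-2-threshold _ = integerWindow⇒2-threshold rank ℤ.-<+ (λ u v _ → ladderAdj⇔rankWindow u v)

ladder-¬0-threshold : ∀ m → ¬ IsKThreshold 0 (Ladder (suc m))
ladder-¬0-threshold _ 0-threshold =
  0-threshold⇒edgeless 0-threshold (0F , 0F) (0F , 1F) (λ ()) (inj₂ (refl , λ ()))

ladder-twoSwitch : ∀ m → TwoSwitch (Ladder (2 ℕ.+ m))
ladder-twoSwitch _ = record
  { a = 0F , 0F ; b = 1F , 0F ; c = 1F , 1F ; d = 0F , 1F
  ; a≢b = λ () ; c≢d = λ () ; a≢c = λ () ; b≢d = λ ()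
  ; ab  = inj₁ (refl , inj₁ refl)
  ; cd  = inj₁ (refl , inj₂ refl)
  ; ¬ac = λ { (inj₁ (() , _)) ; (inj₂ (() , _)) }
  ; ¬bd = λ { (inj₁ (() , _)) ; (inj₂ (() , _)) }
  }

mainTheorem4 : (n : ℕ) → n ≥ 2 → ThresholdNumberIs (Ladder n) 2
mainTheorem4 (suc (suc m)) (s≤s (s≤s z≤n)) = ladder-2-threshold _ , notBelow2
  where
  notBelow2 : ∀ k → k ℕ.< 2 → ¬ IsKThreshold k (Ladder (2 ℕ.+ m))
  notBelow2 0 _ = ladder-¬0-threshold (suc m)
  notBelow2 1 _ = twoSwitch⇒¬1-threshold (ladder-twoSwitch m)
  notBelow2 (suc (suc _)) (s≤s (s≤s ()))
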